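{- Let $\phi$ be the 2-dimensional morphism described in the context and let $x$ be the configuration fixed by $\phi^2$, $x = \lim_{k \rightarrow +\infty}\phi^{2k}(s)$ for the seed $s=\left(\begin{smallmatrix}8 & 12\\1 & 6\end{smallmatrix}\right)$. Then there exists a deterministic finite automaton with output $\mathcal{A}$ such that $x_{\boldsymbol{n}} = \mathcal{A}(\mathrm{rep}_{\mathcal{F}}(\boldsymbol{n}))$ for all $\boldsymbol{n}\in\mathbb{Z}^2$.
   Context: Fibonacci numbers: $F_0=1,F_1=1,F_2=2$, $F_{n+2}=F_{n+1}+F_n$. Let $\Sigma=\{0,1\}$. For an odd-length word $w=w_{2k+1}w_{2k}\cdots w_1\in\Sigma^{2k+1}$ set $\mathrm{val}_\mathcal{F}(w)=\sum_{i=1}^{2k}w_iF_i-w_{2k+1}F_{2k}$. For $n\in\mathbb{Z}$, $\mathrm{rep}_\mathcal{F}(n)$ is the unique odd-length word $w\in\Sigma(\Sigma\Sigma)^*\setminus(\Sigma^*11\Sigma^*\cup000\Sigma^*\cup101\Sigma^*)$ with $\mathrm{val}_\mathcal{F}(w)=n$. For $\boldsymbol{n}=(n_1,n_2)\in\mathbb{Z}^2$, $\mathrm{rep}_\mathcal{F}(\boldsymbol{n})$ is the word over the alphabet of column vectors $\{\binom00,\binom01,\binom10,\binom11\}$ whose top row is $\mathrm{pad}_t(\mathrm{rep}_\mathcal{F}(n_1))$ and bottom row is $\mathrm{pad}_t(\mathrm{rep}_\mathcal{F}(n_2))$, where $t=\max\{|\mathrm{rep}_\mathcal{F}(n_1)|,|\mathrm{rep}_\mathcal{F}(n_2)|\}$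 and $\mathrm{pad}_t(w)=(00)^{(t-|w|)/2}w$ if $w$ starts with $0$, $(10)^{(t-|w|)/2}w$ if $w$ starts with $1$. $\phi$ is the 2-dimensional morphism on $\mathcal{H}=\{0,\dots,15\}$ (2D words written as matrices with Cartesian coordinates, bottom row $=$ row $0$; horizontal dominoes written $(a,b)$ with $a$ at position $(0,0)$): $0\mapsto(14)$, $1\mapsto(13)$, $2\mapsto(12,10)$, $3\mapsto(11,8)$, $4\mapsto(14,7)$, $5\mapsto(13,7)$, $6\mapsto(12,7)$, $7\mapsto\left(\begin{smallmatrix}6\\12\end{smallmatrix}\right)$, $8\mapsto\left(\begin{smallmatrix}3\\14\end{smallmatrix}\right)$, $9\mapsto\left(\begin{smallmatrix}3\\13\end{smallmatrix}\right)$, $10\mapsto\left(\begin{smallmatrix}2\\12\end{smallmatrix}\right)$, $11\mapsto\left(\begin{smallmatrix}6&1\\12&10\end{smallmatrix}\right)$, $12\mapsto\left(\begin{smallmatrix}6&1\\11&8\end{smallmatrix}\right)$, $13\mapsto\left(\begin{smallmatrix}5&1\\15&9\end{smallmatrix}\right)$, $14\mapsto\left(\begin{smallmatrix}4&1\\11&8\end{smallmatrix}\right)$, $15\mapsto\left(\begin{smallmatrix}2&0\\12&7\end{smallmatrix}\right)$. The seed $s$ places one letter in each quadrant: $s_{(-1,0)}=8$, $s_{(0,0)}=12$, $s_{(-1,-1)}=1$, $s_{(0,-1)}=6$; $\phi^2(s)$ prolongates $s$ at the origin, so the limit is a configuration in $\mathcal{H}^{\mathbb{Z}^2}$ fixed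 by $\phi^2$. -}

module Defs where

open import Data.Nat using (ℕ; zero; suc; _+_; _*_; _∸_; _<ᵇ_; ⌊_/2⌋; _⊔_)
open import Data.Integer as ℤ using (ℤ; +_; -[1+_]; ∣_∣)
open import Data.Bool using (Bool; true; false; if_then_else_; _∧_; not)
open import Data.List using (List; []; _∷_; length; _++_; concat; replicate; zip)
open import Data.Product using (_×_; _,_)
open import Data.Fin using (Fin)
open import Relation.Binary.PropositionalEquality using (_≡_)

F : ℕ → ℕ
F zero = 1
F (suc zero) = 1
F (suc (suc n)) = F (suc n) + F n

-- Words over Σ = {0,1} (false = 0, true = 1), written most significant
-- digit first, i.e. the list  w_{2k+1} ∷ w_{2k} ∷ … ∷ w_1 ∷ [] .

digit : Bool → ℕ
digit false = 0
digit true  = 1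

posVal : List Bool → ℕ
posVal [] = 0
posVal (c ∷ cs) = digit c * F (suc (length cs)) + posVal cs

-- val_F(w) = Σ_{i=1}^{2k} w_i F_i − w_{2k+1} F_{2k}
valF : List Bool → ℤ
valF [] = + 0
valF (b ∷ rest) = + posVal rest ℤ.- + (digit b * F (length rest))

isOddLength : List Bool → Bool
isOddLength [] = false
isOddLength (_ ∷ xs) = not (isOddLength xs)

no11 : List Bool → Bool
no11 [] = true
no11 (_ ∷ []) = true
no11 (true ∷ true ∷ _) = false
no11 (_ ∷ y ∷ xs) = no11 (y ∷ xs)

notPrefix000 : List Bool → Bool
notPrefix000 (false ∷ false ∷ false ∷ _) = false
notPrefix000 _ = true

notPrefix101 : List Bool → Bool
notPrefix101 (true ∷ false ∷ true ∷ _) = false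
notPrefix101 _ = true

inRepLang : List Bool → Bool
inRepLang w = isOddLength w ∧ no11 w ∧ notPrefix000 w ∧ notPrefix101 w

-- w = rep_F(n): w is the (unique) word of the language with val_F(w) = n
IsRepF : ℤ → List Bool → Set
IsRepF n w = (inRepLang w ≡ true) × (valF w ≡ n)

pad : ℕ → List Bool → List Bool
pad t [] = []
pad t (b ∷ rest) =
  concat (replicate ⌊ (t ∸ length (b ∷ rest)) /2⌋ (b ∷ false ∷ [])) ++ (b ∷ rest)

pairWord : List Bool → List Bool → List (Bool × Bool)
pairWord w₁ w₂ = zip (pad t w₁) (pad t w₂)
  where t = length w₁ ⊔ length w₂

data Letter : Set where
  h0 h1 h2 h3 h4 h5 h6 h7 h8 h9 h10 h11 h12 h13 h14 h15 : Letter

-- shapes of images: a single letter, a horizontal domino (a at (0,0), b at (1,0)),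
-- a vertical domino (top, bottom) with bottom at (0,0), and a 2×2 square
-- (topLeft, topRight, bottomLeft, bottomRight) with bottomLeft at (0,0).
data Image : Set where
  one : Letter → Image
  hor : Letter → Letter → Image
  ver : Letter → Letter → Image
  sq  : Letter → Letter → Letter → Letter → Image

φ : Letter → Image
φ h0  = one h14
φ h1  = one h13
φ h2  = hor h12 h10
φ h3  = hor h11 h8
φ h4  = hor h14 h7
φ h5  = hor h13 h7
φ h6  = hor h12 h7
φ h7  = ver h6 h12
φ h8  = ver h3 h14
φ h9  = ver h3 h13
φ h10 = ver h2 h12
φ h11 = sq h6 h1 h12 h10
φ h12 = sq h6 h1 h11 h8
φ h13 = sq h5 h1 h15 h9
φ h14 = sq h4 h1 h11 h8
φ h15 = sq h2 h0 h12 h7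

-- width and height of the rectangular block φᵏ(a)
-- (φ^{k+1}(a) is obtained by replacing each letter b of φ(a) by φᵏ(b))
width : ℕ → Letter → ℕ
width zero a = 1
width (suc k) a with φ a
... | one b = width k b
... | hor b c = width k b + width k c
... | ver t b = width k b
... | sq tl tr bl br = width k bl + width k br

height : ℕ → Letter → ℕ
height zero a = 1
height (suc k) a with φ a
... | one b = height k b
... | hor b c = height k b
... | ver t b = height k b + height k t
... | sq tl tr bl br = height k bl + height k tl

-- blockAt k a i j = the letter of φᵏ(a) at position (i , j), Cartesian
-- coordinates with (0,0) the bottom-left corner (meaningful for
-- i < width k a, j < height k a).
blockAt : ℕ → Letter → ℕ → ℕ → Letter
blockAt zero a i j = a
blockAt (suc k) a i j with φ a
... | one b = blockAt k b i j
... | hor b c =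
  if i <ᵇ width k b then blockAt k b i j else blockAt k c (i ∸ width k b) j
... | ver t b =
  if j <ᵇ height k b then blockAt k b i j else blockAt k t i (j ∸ height k b)
... | sq tl tr bl br =
  if i <ᵇ width k bl
  then (if j <ᵇ height k bl then blockAt k bl i j
        else blockAt k tl i (j ∸ height k bl))
  else (if j <ᵇ height k br then blockAt k br (i ∸ width k bl) j
        else blockAt k tr (i ∸ width k bl) (j ∸ height k br))

-- φ^{2k}(s) for the seed s_{(-1,0)} = 8, s_{(0,0)} = 12, s_{(-1,-1)} = 1,
-- s_{(0,-1)} = 6: the four blocks φ^{2k}(8), φ^{2k}(12), φ^{2k}(1), φ^{2k}(6)
-- sit in the four quadrants with their corners at the origin.
iterSeed : ℕ → ℤ × ℤ → Letter
iterSeed k (+ i , + j) = blockAt (2 * k) h12 i j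
iterSeed k (-[1+ a ] , + j) =
  blockAt (2 * k) h8 (width (2 * k) h8 ∸ suc a) j
iterSeed k (+ i , -[1+ b ]) =
  blockAt (2 * k) h6 i (height (2 * k) h6 ∸ suc b)
iterSeed k (-[1+ a ] , -[1+ b ]) =
  blockAt (2 * k) h1 (width (2 * k) h1 ∸ suc a) (height (2 * k) h1 ∸ suc b)

-- Since φ²(s) prolongates s, the value at n stabilises
-- as soon as n lies in the support of φ^{2k}(s); k = |n₁| + |n₂| + 1 suffices
-- (all four blocks of φ^{2k}(s) have width and height ≥ k + 1).
x : ℤ × ℤ → Letter
x (n₁ , n₂) = iterSeed (∣ n₁ ∣ + ∣ n₂ ∣ + 1) (n₁ , n₂)

-- Deterministic finite automata with output, over the alphabet of
-- column vectors Σ² = Bool × Bool (top, bottom), reading words left to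
-- right (most significant digit first), with output alphabet 𝓗.

record DFAO : Set where
  field
    nStates : ℕ
    start   : Fin nStates
    δ       : Fin nStates → Bool × Bool → Fin nStates
    τ       : Fin nStates → Letter

runFrom : (A : DFAO) → Fin (DFAO.nStates A) → List (Bool × Bool) → Fin (DFAO.nStates A)
runFrom A q [] = q
runFrom A q (c ∷ cs) = runFrom A (DFAO.δ A q c) cs

output : DFAO → List (Bool × Bool) → Letter
output A w = DFAO.τ A (runFrom A (DFAO.start A) w)

{-# OPTIONS --safe #-}
-- The block φᴸ(a) is F(L+1) or F(L) wide according as φ(a) has two columns
-- or one (likewise for heights), and the letter in column d, row e of φ(a)
-- has two columns iff d = 0 and two rows iff e = 0.  Hence the positions along
-- an axis of φᴸ(a) are the values of the Zeckendorf words of length L (starting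
-- with 0 when a is narrow), and a leading digit pair (d , e) selects the
-- sub-block φᴸ⁻¹(a′) of φᴸ(a), a′ the letter at (d , e) of φ(a): reading digit
-- pairs from the left is a letter-to-letter automaton.  A representation of n
-- padded to length 2K + 1 starts with 1 iff n < 0, and its tail is the position
-- of n in the block φ²ᴷ(s_q) of the quadrant q of n; padding further does not
-- change the output because φ²(s) prolongates s.
module Submission where

open import Defs
open import Data.Integer using (ℤ)
open import Data.List using (List)
open import Data.Bool using (Bool)
open import Data.Product using (∃; _,_)
open import Relation.Binary.PropositionalEquality using (_≡_)

open import Data.Bool using (true; false; if_then_else_; not; T; _∧_)
open import Data.Bool.Properties using (not-involutive)
open import Data.Empty using (⊥-elim)
open import Data.Fin using (Fin; zero; suc; #_)
open import Data.Integer as ℤ using (+_; -[1+_]; ∣_∣; _⊖_)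
import Data.Integer.Properties as ℤP
open import Data.List using ([]; _∷_; _++_; length; zip; foldl; lookup; concat; replicate)
open import Data.Maybe using (Maybe; just; nothing)
open import Data.Nat using (ℕ; zero; suc; _+_; _*_; _∸_; _⊔_; _≤_; _<_; _<ᵇ_; ⌊_/2⌋; z≤n; s≤s)
open import Data.Nat.Properties
open import Algebra.Properties.CommutativeSemigroup +-commutativeSemigroup using (x∙yz≈y∙xz)
open import Data.Product using (_×_; proj₂)
open import Relation.Nullary using (¬_)
open import Relation.Binary.PropositionalEquality using (refl; sym; trans; cong; cong₂; subst; module ≡-Reasoning)
open ≡-Reasoning

1≤F : ∀ n → 1 ≤ F n
1≤F zero = s≤s z≤n
1≤F (suc zero) = s≤s z≤n
1≤F (suc (suc n)) = ≤-trans (1≤F (suc n)) (m≤m+n _ _)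

n≤F : ∀ n → n ≤ F n
n≤F zero = z≤n
n≤F (suc zero) = s≤s z≤n
n≤F (suc (suc n)) =
  subst (_≤ F (suc (suc n))) (+-comm (suc n) 1) (+-mono-≤ (n≤F (suc n)) (1≤F n))

blockSize : Bool → ℕ → ℕ
blockSize true k = F (suc k)
blockSize false k = F k

blockSize-zero : ∀ w → blockSize w 0 ≡ 1
blockSize-zero true = refl
blockSize-zero false = refl

if-T : ∀ {A : Set} b {x y : A} → T b → (if b then x else y) ≡ x
if-T true _ = refl

if-¬T : ∀ {A : Set} b {x y : A} → ¬ T b → (if b then x else y) ≡ y
if-¬T false _ = refl
if-¬T true ¬t = ⊥-elim (¬t _)

∧-true : ∀ x {y} → x ∧ y ≡ true → x ≡ true × y ≡ true
∧-true true y≡true = refl , y≡true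

[+m]-[+n]≡[+p]-[+q] : ∀ m n p q → m + q ≡ p + n → + m ℤ.- + n ≡ + p ℤ.- + q
[+m]-[+n]≡[+p]-[+q] m n p q m+q≡p+n = begin
  + m ℤ.- + n        ≡⟨ ℤP.[+m]-[+n]≡m⊖n m n ⟩
  m ⊖ n              ≡⟨ ℤP.+-cancelˡ-⊖ q m n ⟨
  (q + m) ⊖ (q + n)  ≡⟨ cong₂ _⊖_ (trans (+-comm q m) (trans m+q≡p+n (+-comm p n))) (+-comm q n) ⟩
  (n + p) ⊖ (n + q)  ≡⟨ ℤP.+-cancelˡ-⊖ n p q ⟩
  p ⊖ q              ≡⟨ ℤP.[+m]-[+n]≡m⊖n p q ⟨
  + p ℤ.- + q        ∎

data Zeck : ℕ → Bool → List Bool → Set where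
  []  : ∀ {f} → Zeck 0 f []
  0∷_ : ∀ {L f u} → Zeck L true u → Zeck (suc L) f (false ∷ u)
  1∷_ : ∀ {L u} → Zeck L false u → Zeck (suc L) true (true ∷ u)

Zeck-length : ∀ {L f u} → Zeck L f u → length u ≡ L
Zeck-length [] = refl
Zeck-length (0∷ z) = cong suc (Zeck-length z)
Zeck-length (1∷ z) = cong suc (Zeck-length z)

Zeck-tail : ∀ {L f b u} → Zeck (suc L) f (b ∷ u) → Zeck L (not b) u
Zeck-tail (0∷ z) = z
Zeck-tail (1∷ z) = z

Zeck-cons : ∀ {L u} b → Zeck L (not b) u → Zeck (suc L) true (b ∷ u)
Zeck-cons false z = 0∷ z
Zeck-cons true z = 1∷ z

Zeck-of-no11 : ∀ b u → no11 (b ∷ u) ≡ true → Zeck (length u) (not b) u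
Zeck-of-no11 _ [] _ = []
Zeck-of-no11 false (false ∷ u) h = 0∷ Zeck-of-no11 false u h
Zeck-of-no11 false (true ∷ u) h = 1∷ Zeck-of-no11 true u h
Zeck-of-no11 true (false ∷ u) h = 0∷ Zeck-of-no11 false u h
Zeck-of-no11 true (true ∷ u) ()

posVal-true : ∀ u → posVal (true ∷ u) ≡ F (suc (length u)) + posVal u
posVal-true u = cong (_+ posVal u) (*-identityˡ (F (suc (length u))))

posVal-1∷ : ∀ {L f u} → Zeck L f u → posVal (true ∷ u) ≡ F (suc L) + posVal u
posVal-1∷ {u = u} z = trans (posVal-true u) (cong (λ l → F (suc l) + posVal u) (Zeck-length z))

posVal-< : ∀ {L f u} → Zeck L f u → posVal u < blockSize f L
posVal-< {f = true} [] = s≤s z≤n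
posVal-< {f = false} [] = s≤s z≤n
posVal-< {f = false} (0∷ z) = posVal-< z
posVal-< {f = true} (0∷ z) = <-≤-trans (posVal-< z) (m≤m+n _ _)
posVal-< {L = suc L} (1∷ z) =
  subst (_< F (suc (suc L))) (sym (posVal-1∷ z)) (+-monoʳ-< (F (suc L)) (posVal-< z))

1+length≤posVal : ∀ {L f u} → Zeck L f u → suc L ≤ posVal (true ∷ u)
1+length≤posVal {L} z =
  ≤-trans (n≤F (suc L)) (subst (F (suc L) ≤_) (sym (posVal-1∷ z)) (m≤m+n _ _))

split-at-leading-digit : ∀ {A : Set} {L d u W} → Zeck (suc L) true (d ∷ u) → W ≡ F (suc L) →
  (f : Bool → ℕ → A) →
  (if posVal (d ∷ u) <ᵇ W then f false (posVal (d ∷ u)) else f true (posVal (d ∷ u) ∸ W))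
    ≡ f d (posVal u)
split-at-leading-digit {L = L} {u = u} (0∷ z) refl _ =
  if-T (posVal u <ᵇ F (suc L)) (<⇒<ᵇ (posVal-< z))
split-at-leading-digit {L = L} {u = u} (1∷ z) refl f = begin
  (if i <ᵇ F (suc L) then f false i else f true (i ∸ F (suc L)))
    ≡⟨ if-¬T (i <ᵇ F (suc L)) i≮F ⟩
  f true (i ∸ F (suc L))
    ≡⟨ cong (λ j → f true (j ∸ F (suc L))) (posVal-1∷ z) ⟩
  f true (F (suc L) + posVal u ∸ F (suc L))
    ≡⟨ cong (f true) (m+n∸m≡n (F (suc L)) (posVal u)) ⟩
  f true (posVal u) ∎
  where
  i = posVal (true ∷ u)
  i≮F : ¬ T (i <ᵇ F (suc L))
  i≮F i<F = m+n≮m (F (suc L)) (posVal u) (subst (_< F (suc L)) (posVal-1∷ z) (<ᵇ⇒< _ _ i<F))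

wide tall : Image → Bool
wide (hor _ _) = true
wide (sq _ _ _ _) = true
wide _ = false
tall (ver _ _) = true
tall (sq _ _ _ _) = true
tall _ = false

class : Letter → Bool × Bool
class a = wide (φ a) , tall (φ a)

letterAt : Image → Bool × Bool → Letter
letterAt (one b) _ = b
letterAt (hor b c) (d , _) = if d then c else b
letterAt (ver t b) (_ , e) = if e then t else b
letterAt (sq tl tr bl br) (d , e) = if d then (if e then tr else br) else (if e then tl else bl)

step : Letter → Bool × Bool → Letter
step a = letterAt (φ a)

-- The letter in column d and row e of the image has class (not d , not e).
data Shaped : Image → Set where
  one : ∀ {b} → class b ≡ (true , true) → Shaped (one b)
  hor : ∀ {b c} → class b ≡ (true , true) → class c ≡ (false , true) → Shaped (hor b c)
  ver : ∀ {t b} → class t ≡ (true , false) → class b ≡ (true , true) → Shaped (ver t b)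
  sq  : ∀ {tl tr bl br} → class tl ≡ (true , false) → class tr ≡ (false , false) →
        class bl ≡ (true , true) → class br ≡ (false , true) → Shaped (sq tl tr bl br)

φ-shaped : ∀ a → Shaped (φ a)
φ-shaped h0 = one refl
φ-shaped h1 = one refl
φ-shaped h2 = hor refl refl
φ-shaped h3 = hor refl refl
φ-shaped h4 = hor refl refl
φ-shaped h5 = hor refl refl
φ-shaped h6 = hor refl refl
φ-shaped h7 = ver refl refl
φ-shaped h8 = ver refl refl
φ-shaped h9 = ver refl refl
φ-shaped h10 = ver refl refl
φ-shaped h11 = sq refl refl refl refl
φ-shaped h12 = sq refl refl refl refl
φ-shaped h13 = sq refl refl refl refl
φ-shaped h14 = sq refl refl refl refl
φ-shaped h15 = sq refl refl refl refl

width-size : ∀ k {a w t} → class a ≡ (w , t) → width k a ≡ blockSize w k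
width-size zero {w = w} _ = sym (blockSize-zero w)
width-size (suc k) {a} refl with φ a | φ-shaped a
... | one _ | one c = width-size k c
... | hor _ _ | hor c c′ = cong₂ _+_ (width-size k c) (width-size k c′)
... | ver _ _ | ver _ c = width-size k c
... | sq _ _ _ _ | sq _ _ c c′ = cong₂ _+_ (width-size k c) (width-size k c′)

height-size : ∀ k {a w t} → class a ≡ (w , t) → height k a ≡ blockSize t k
height-size zero {t = t} _ = sym (blockSize-zero t)
height-size (suc k) {a} refl with φ a | φ-shaped a
... | one _ | one c = height-size k c
... | hor _ _ | hor c _ = height-size k c
... | ver _ _ | ver c′ c = cong₂ _+_ (height-size k c) (height-size k c′)
... | sq _ _ _ _ | sq c′ _ c _ = cong₂ _+_ (height-size k c) (height-size k c′)

class-step : ∀ a {L d e u v} → Zeck (suc L) (wide (φ a)) (d ∷ u) → Zeck (suc L) (tall (φ a)) (e ∷ v) →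
  class (step a (d , e)) ≡ (not d , not e)
class-step a zu zv with φ a | φ-shaped a
class-step a (0∷ _) (0∷ _) | one _ | one c = c
class-step a (0∷ _) (0∷ _) | hor _ _ | hor c _ = c
class-step a (1∷ _) (0∷ _) | hor _ _ | hor _ c = c
class-step a (0∷ _) (0∷ _) | ver _ _ | ver _ c = c
class-step a (0∷ _) (1∷ _) | ver _ _ | ver c _ = c
class-step a (0∷ _) (0∷ _) | sq _ _ _ _ | sq _ _ c _ = c
class-step a (1∷ _) (0∷ _) | sq _ _ _ _ | sq _ _ _ c = c
class-step a (0∷ _) (1∷ _) | sq _ _ _ _ | sq c _ _ _ = c
class-step a (1∷ _) (1∷ _) | sq _ _ _ _ | sq _ c _ _ = c

blockAt-step : ∀ {L} a {d e u v} → Zeck (suc L) (wide (φ a)) (d ∷ u) → Zeck (suc L) (tall (φ a)) (e ∷ v) →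
  blockAt (suc L) a (posVal (d ∷ u)) (posVal (e ∷ v)) ≡ blockAt L (step a (d , e)) (posVal u) (posVal v)
blockAt-step a zu zv with φ a | φ-shaped a
blockAt-step a (0∷ _) (0∷ _) | one _ | _ = refl
blockAt-step {L} a {v = v} zu (0∷ _) | hor b c | hor cb _ =
  split-at-leading-digit zu (width-size L cb) (λ d i → blockAt L (if d then c else b) i (posVal v))
blockAt-step {L} a {u = u} (0∷ _) zv | ver t b | ver _ cb =
  split-at-leading-digit zv (height-size L cb) (λ e j → blockAt L (if e then t else b) (posVal u) j)
blockAt-step {L} a {d} {e} {u} {v} zu zv | sq tl tr bl br | sq _ _ cbl cbr =
  trans (split-at-leading-digit zu (width-size L cbl) column)
        (split-at-leading-digit zv (bottom-height d)
          (λ e′ j → blockAt L (letterAt (sq tl tr bl br) (d , e′)) (posVal u) j))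
  where
  bottom : Bool → Letter
  bottom d = if d then br else bl
  column : Bool → ℕ → Letter
  column d i = if posVal (e ∷ v) <ᵇ height L (bottom d)
               then blockAt L (bottom d) i (posVal (e ∷ v))
               else blockAt L (if d then tr else tl) i (posVal (e ∷ v) ∸ height L (bottom d))
  bottom-height : ∀ d → height L (bottom d) ≡ F (suc L)
  bottom-height false = height-size L cbl
  bottom-height true = height-size L cbr

blockAt-foldl : ∀ L {a w t u v} → class a ≡ (w , t) → Zeck L w u → Zeck L t v →
  blockAt L a (posVal u) (posVal v) ≡ foldl step a (zip u v)
blockAt-foldl zero _ [] [] = refl
blockAt-foldl (suc L) {u = []} _ () _
blockAt-foldl (suc L) {v = []} _ _ ()
blockAt-foldl (suc L) {a} {u = _ ∷ _} {v = _ ∷ _} refl zu zv =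
  trans (blockAt-step a zu zv) (blockAt-foldl L (class-step a zu zv) (Zeck-tail zu) (Zeck-tail zv))

-- The leading digit of a representation is 1 iff the number is negative, so
-- the first digit pair of pairWord selects the quadrant of s.
seed : Bool × Bool → Letter
seed (false , false) = h12
seed (true , false) = h8
seed (false , true) = h6
seed (true , true) = h1

seed-class : ∀ b₁ b₂ → class (seed (b₁ , b₂)) ≡ (not b₁ , not b₂)
seed-class false false = refl
seed-class true false = refl
seed-class false true = refl
seed-class true true = refl

seed-prolongable : ∀ c → step (step (seed c) (false , false)) c ≡ seed c
seed-prolongable (false , false) = refl
seed-prolongable (true , false) = refl
seed-prolongable (false , true) = refl
seed-prolongable (true , true) = refl

blocks : ℕ → Bool → List Bool
blocks zero _ = []
blocks (suc d) b = false ∷ b ∷ blocks d b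

extend : ℕ → List Bool → List Bool
extend _ [] = []
extend d (b ∷ r) = b ∷ blocks d b ++ r

foldl-step-blocks : ∀ d b₁ b₂ {u v} →
  foldl step (seed (b₁ , b₂)) (zip (blocks d b₁ ++ u) (blocks d b₂ ++ v))
    ≡ foldl step (seed (b₁ , b₂)) (zip u v)
foldl-step-blocks zero _ _ = refl
foldl-step-blocks (suc d) b₁ b₂ {u} {v} =
  trans (cong (λ a → foldl step a (zip (blocks d b₁ ++ u) (blocks d b₂ ++ v)))
              (seed-prolongable (b₁ , b₂)))
        (foldl-step-blocks d b₁ b₂)

module EncodedStates {S : Set} {n : ℕ} (encode : S → Fin n) (decode : Fin n → S)
                     (decode-encode : ∀ s → decode (encode s) ≡ s)
                     (s₀ : S) (next : S → Bool × Bool → S) (out : S → Letter) where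

  dfao : DFAO
  dfao = record
    { nStates = n
    ; start = encode s₀
    ; δ = λ q c → encode (next (decode q) c)
    ; τ = λ q → out (decode q)
    }

  decode-runFrom : ∀ s w → decode (runFrom dfao (encode s) w) ≡ foldl next s w
  decode-runFrom s [] = decode-encode s
  decode-runFrom s (c ∷ w) rewrite decode-encode s = decode-runFrom (next s c) w

  output-dfao : ∀ w → output dfao w ≡ out (foldl next s₀ w)
  output-dfao w = cong out (decode-runFrom s₀ w)

letters : List Letter
letters = h0 ∷ h1 ∷ h2 ∷ h3 ∷ h4 ∷ h5 ∷ h6 ∷ h7 ∷ h8 ∷ h9 ∷ h10 ∷ h11 ∷ h12 ∷ h13 ∷ h14 ∷ h15 ∷ []

index : Letter → Fin 16
index h0 = # 0
index h1 = # 1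
index h2 = # 2
index h3 = # 3
index h4 = # 4
index h5 = # 5
index h6 = # 6
index h7 = # 7
index h8 = # 8
index h9 = # 9
index h10 = # 10
index h11 = # 11
index h12 = # 12
index h13 = # 13
index h14 = # 14
index h15 = # 15

lookup-index : ∀ a → lookup letters (index a) ≡ a
lookup-index h0 = refl
lookup-index h1 = refl
lookup-index h2 = refl
lookup-index h3 = refl
lookup-index h4 = refl
lookup-index h5 = refl
lookup-index h6 = refl
lookup-index h7 = refl
lookup-index h8 = refl
lookup-index h9 = refl
lookup-index h10 = refl
lookup-index h11 = refl
lookup-index h12 = refl
lookup-index h13 = refl
lookup-index h14 = refl
lookup-index h15 = refl

encode : Maybe Letter → Fin 17
encode nothing = zero
encode (just a) = suc (index a)

decode : Fin 17 → Maybe Letter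
decode zero = nothing
decode (suc i) = just (lookup letters i)

decode-encode : ∀ s → decode (encode s) ≡ s
decode-encode nothing = refl
decode-encode (just a) = cong just (lookup-index a)

next : Maybe Letter → Bool × Bool → Maybe Letter
next nothing c = just (seed c)
next (just a) c = just (step a c)

-- Only the empty word, which is no pair of representations, ends in nothing.
out : Maybe Letter → Letter
out nothing = h0
out (just a) = a

open EncodedStates encode decode decode-encode nothing next out
  using (output-dfao) renaming (dfao to 𝒜)

foldl-next : ∀ a w → foldl next (just a) w ≡ just (foldl step a w)
foldl-next a [] = refl
foldl-next a (c ∷ w) = foldl-next (step a c) w

output-𝒜 : ∀ c w → output 𝒜 (c ∷ w) ≡ foldl step (seed c) w
output-𝒜 c w = trans (output-dfao (c ∷ w)) (cong out (foldl-next (seed c) w))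

output-extend : ∀ d w₁ w₂ → output 𝒜 (zip (extend d w₁) (extend d w₂)) ≡ output 𝒜 (zip w₁ w₂)
output-extend d [] _ = refl
output-extend d (_ ∷ _) [] = refl
output-extend d (b₁ ∷ r₁) (b₂ ∷ r₂) = begin
  output 𝒜 ((b₁ , b₂) ∷ zip (blocks d b₁ ++ r₁) (blocks d b₂ ++ r₂))
    ≡⟨ output-𝒜 (b₁ , b₂) (zip (blocks d b₁ ++ r₁) (blocks d b₂ ++ r₂)) ⟩
  foldl step (seed (b₁ , b₂)) (zip (blocks d b₁ ++ r₁) (blocks d b₂ ++ r₂))
    ≡⟨ foldl-step-blocks d b₁ b₂ ⟩
  foldl step (seed (b₁ , b₂)) (zip r₁ r₂)
    ≡⟨ output-𝒜 (b₁ , b₂) (zip r₁ r₂) ⟨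
  output 𝒜 ((b₁ , b₂) ∷ zip r₁ r₂) ∎

replicate-rotate : ∀ d b r → concat (replicate d (b ∷ false ∷ [])) ++ b ∷ r ≡ b ∷ blocks d b ++ r
replicate-rotate zero b r = refl
replicate-rotate (suc d) b r = cong (λ w → b ∷ false ∷ w) (replicate-rotate d b r)

⌊2*n/2⌋≡n : ∀ n → ⌊ 2 * n /2⌋ ≡ n
⌊2*n/2⌋≡n n = sym (trans (n≡⌊n+n/2⌋ n) (cong (λ k → ⌊ n + k /2⌋) (sym (+-identityʳ n))))

pad-as-extend : ∀ {m} M {w} → Zeck (suc (2 * m)) true w → pad (suc (2 * M)) w ≡ extend (M ∸ m) w
pad-as-extend {m} M {b ∷ r} z = begin
  concat (replicate ⌊ (2 * M ∸ length r) /2⌋ (b ∷ false ∷ [])) ++ b ∷ r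
    ≡⟨ cong (λ d → concat (replicate d (b ∷ false ∷ [])) ++ b ∷ r) blocks-needed ⟩
  concat (replicate (M ∸ m) (b ∷ false ∷ [])) ++ b ∷ r
    ≡⟨ replicate-rotate (M ∸ m) b r ⟩
  extend (M ∸ m) (b ∷ r) ∎
  where
  blocks-needed : ⌊ (2 * M ∸ length r) /2⌋ ≡ M ∸ m
  blocks-needed = begin
    ⌊ (2 * M ∸ length r) /2⌋  ≡⟨ cong (λ l → ⌊ (2 * M ∸ l) /2⌋) (Zeck-length (Zeck-tail z)) ⟩
    ⌊ (2 * M ∸ 2 * m) /2⌋     ≡⟨ cong ⌊_/2⌋ (*-distribˡ-∸ 2 M m) ⟨
    ⌊ 2 * (M ∸ m) /2⌋         ≡⟨ ⌊2*n/2⌋≡n (M ∸ m) ⟩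
    M ∸ m                     ∎

pairWord-extend : ∀ {m₁ m₂ w₁ w₂} → Zeck (suc (2 * m₁)) true w₁ → Zeck (suc (2 * m₂)) true w₂ →
  pairWord w₁ w₂ ≡ zip (extend ((m₁ ⊔ m₂) ∸ m₁) w₁) (extend ((m₁ ⊔ m₂) ∸ m₂) w₂)
pairWord-extend {m₁} {m₂} {w₁} {w₂} z₁ z₂ = begin
  zip (pad (length w₁ ⊔ length w₂) w₁) (pad (length w₁ ⊔ length w₂) w₂)
    ≡⟨ cong (λ t → zip (pad t w₁) (pad t w₂)) common-length ⟩
  zip (pad (suc (2 * M)) w₁) (pad (suc (2 * M)) w₂)
    ≡⟨ cong₂ zip (pad-as-extend {m₁} M z₁) (pad-as-extend {m₂} M z₂) ⟩
  zip (extend (M ∸ m₁) w₁) (extend (M ∸ m₂) w₂) ∎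
  where
  M = m₁ ⊔ m₂
  common-length : length w₁ ⊔ length w₂ ≡ suc (2 * M)
  common-length =
    trans (cong₂ _⊔_ (Zeck-length z₁) (Zeck-length z₂)) (cong suc (sym (*-distribˡ-⊔ 2 m₁ m₂)))

Zeck-blocks : ∀ d b {L r} → Zeck L (not b) r → Zeck (2 * d + L) (not b) (blocks d b ++ r)
Zeck-blocks zero b z = z
Zeck-blocks (suc d) b {L} {r} z =
  subst (λ l → Zeck l (not b) (blocks (suc d) b ++ r)) (sym (cong (_+ L) (*-suc 2 d)))
    (0∷ Zeck-cons b (Zeck-blocks d b z))

Zeck-extend : ∀ {m M w} → m ≤ M → Zeck (suc (2 * m)) true w → Zeck (suc (2 * M)) true (extend (M ∸ m) w)
Zeck-extend {w = []} _ ()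
Zeck-extend {m} {M} {b ∷ r} m≤M z =
  subst (λ l → Zeck (suc l) true (extend (M ∸ m) (b ∷ r))) total-length
    (Zeck-cons b (Zeck-blocks (M ∸ m) b (Zeck-tail z)))
  where
  total-length : 2 * (M ∸ m) + 2 * m ≡ 2 * M
  total-length = trans (sym (*-distribˡ-+ 2 (M ∸ m) m)) (cong (2 *_) (m∸n+n≡m m≤M))

posVal-zero-blocks : ∀ d r → posVal (blocks d false ++ r) ≡ posVal r
posVal-zero-blocks zero r = refl
posVal-zero-blocks (suc d) r = posVal-zero-blocks d r

posVal-one-blocks : ∀ d r →
  posVal (blocks d true ++ r) + F (length r) ≡ posVal r + F (length (blocks d true ++ r))
posVal-one-blocks zero r = refl
posVal-one-blocks (suc d) r = begin
  posVal (true ∷ Y) + F (length r)      ≡⟨ cong (_+ F (length r)) (posVal-true Y) ⟩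
  F (suc ℓ) + posVal Y + F (length r)   ≡⟨ +-assoc (F (suc ℓ)) (posVal Y) (F (length r)) ⟩
  F (suc ℓ) + (posVal Y + F (length r)) ≡⟨ cong (λ k → F (suc ℓ) + k) (posVal-one-blocks d r) ⟩
  F (suc ℓ) + (posVal r + F ℓ)          ≡⟨ x∙yz≈y∙xz (F (suc ℓ)) (posVal r) (F ℓ) ⟩
  posVal r + (F (suc ℓ) + F ℓ)          ∎
  where
  Y = blocks d true ++ r
  ℓ = length Y

valF-true : ∀ r → valF (true ∷ r) ≡ + posVal r ℤ.- + F (length r)
valF-true r = cong (λ q → + posVal r ℤ.- + q) (*-identityˡ (F (length r)))

valF-extend : ∀ d w → valF (extend d w) ≡ valF w
valF-extend d [] = refl
valF-extend d (false ∷ r) = cong (λ p → + p ℤ.- + 0) (posVal-zero-blocks d r)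
valF-extend d (true ∷ r) = begin
  valF (true ∷ blocks d true ++ r)
    ≡⟨ valF-true (blocks d true ++ r) ⟩
  + posVal (blocks d true ++ r) ℤ.- + F (length (blocks d true ++ r))
    ≡⟨ [+m]-[+n]≡[+p]-[+q] _ _ (posVal r) (F (length r)) (posVal-one-blocks d r) ⟩
  + posVal r ℤ.- + F (length r)
    ≡⟨ valF-true r ⟨
  valF (true ∷ r) ∎

-- A negative n = p - F L lies at position p of a block whose far edge is the origin.
data Coordinate (L : ℕ) : Bool → ℤ → ℕ → Set where
  nonneg : ∀ p → Coordinate L false (+ p) p
  neg    : ∀ {p} a → p + suc a ≡ F L → Coordinate L true -[1+ a ] p

coordinate : ∀ {L b r} → Zeck (suc L) true (b ∷ r) → Coordinate L b (valF (b ∷ r)) (posVal r)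
coordinate {L} {false} {r} _ =
  subst (λ n → Coordinate L false n (posVal r)) (sym (ℤP.+-identityʳ (+ posVal r))) (nonneg (posVal r))
coordinate {L} {true} {r} z = subst (λ n → Coordinate L true n p) (sym value) (neg a sum)
  where
  p = posVal r
  a = F L ∸ suc p
  sum : p + suc a ≡ F L
  sum = trans (+-suc p a) (m+[n∸m]≡n (posVal-< (Zeck-tail z)))
  value : valF (true ∷ r) ≡ -[1+ a ]
  value = begin
    valF (true ∷ r)          ≡⟨ valF-true r ⟩
    + p ℤ.- + F (length r)   ≡⟨ cong (λ l → + p ℤ.- + F l) (Zeck-length (Zeck-tail z)) ⟩
    + p ℤ.- + F L            ≡⟨ cong (λ q → + p ℤ.- + q) sum ⟨
    + p ℤ.- + (p + suc a)    ≡⟨ [+m]-[+n]≡[+p]-[+q] p (p + suc a) 0 (suc a) refl ⟩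
    -[1+ a ]                 ∎

from-far-edge : ∀ {W S p a} → W ≡ S → p + suc a ≡ S → W ∸ suc a ≡ p
from-far-edge {p = p} {a} W≡S sum = trans (cong (_∸ suc a) (trans W≡S (sym sum))) (m+n∸n≡m p (suc a))

iterSeed-coordinate : ∀ {K b₁ b₂ n₁ n₂ p₁ p₂} → Coordinate (2 * K) b₁ n₁ p₁ → Coordinate (2 * K) b₂ n₂ p₂ →
  iterSeed K (n₁ , n₂) ≡ blockAt (2 * K) (seed (b₁ , b₂)) p₁ p₂
iterSeed-coordinate (nonneg _) (nonneg _) = refl
iterSeed-coordinate {K} (neg _ e) (nonneg q) =
  cong (λ i → blockAt (2 * K) h8 i q) (from-far-edge (width-size (2 * K) {h8} refl) e)
iterSeed-coordinate {K} (nonneg p) (neg _ e) =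
  cong (blockAt (2 * K) h6 p) (from-far-edge (height-size (2 * K) {h6} refl) e)
iterSeed-coordinate {K} (neg {p} a e₁) (neg {q} b e₂) =
  cong₂ (blockAt (2 * K) h1) (from-far-edge {p = p} {a} (width-size (2 * K) {h1} refl) e₁)
                             (from-far-edge {p = q} {b} (height-size (2 * K) {h1} refl) e₂)

iterSeed-output : ∀ {K w₁ w₂} → Zeck (suc (2 * K)) true w₁ → Zeck (suc (2 * K)) true w₂ →
  iterSeed K (valF w₁ , valF w₂) ≡ output 𝒜 (zip w₁ w₂)
iterSeed-output {w₁ = []} () _
iterSeed-output {w₂ = []} _ ()
iterSeed-output {K} {b₁ ∷ r₁} {b₂ ∷ r₂} z₁ z₂ = begin
  iterSeed K (valF (b₁ ∷ r₁) , valF (b₂ ∷ r₂))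
    ≡⟨ iterSeed-coordinate (coordinate z₁) (coordinate z₂) ⟩
  blockAt (2 * K) (seed (b₁ , b₂)) (posVal r₁) (posVal r₂)
    ≡⟨ blockAt-foldl (2 * K) (seed-class b₁ b₂) (Zeck-tail z₁) (Zeck-tail z₂) ⟩
  foldl step (seed (b₁ , b₂)) (zip r₁ r₂)
    ≡⟨ output-𝒜 (b₁ , b₂) (zip r₁ r₂) ⟨
  output 𝒜 (zip (b₁ ∷ r₁) (b₂ ∷ r₂)) ∎

iterSeed-output-≤ : ∀ {K M w₁ w₂} → M ≤ K → Zeck (suc (2 * M)) true w₁ → Zeck (suc (2 * M)) true w₂ →
  iterSeed K (valF w₁ , valF w₂) ≡ output 𝒜 (zip w₁ w₂)
iterSeed-output-≤ {K} {M} {w₁} {w₂} M≤K z₁ z₂ = begin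
  iterSeed K (valF w₁ , valF w₂)
    ≡⟨ cong₂ (λ v₁ v₂ → iterSeed K (v₁ , v₂)) (valF-extend d w₁) (valF-extend d w₂) ⟨
  iterSeed K (valF (extend d w₁) , valF (extend d w₂))
    ≡⟨ iterSeed-output (Zeck-extend M≤K z₁) (Zeck-extend M≤K z₂) ⟩
  output 𝒜 (zip (extend d w₁) (extend d w₂))
    ≡⟨ output-extend d w₁ w₂ ⟩
  output 𝒜 (zip w₁ w₂) ∎
  where d = K ∸ M

nonneg-length-bound : ∀ {L r} → Zeck L true r → notPrefix000 (false ∷ r) ≡ true → L ≤ suc (posVal r)
nonneg-length-bound [] _ = z≤n
nonneg-length-bound (0∷ []) _ = s≤s z≤n
nonneg-length-bound (0∷ 0∷ _) ()
nonneg-length-bound (0∷ 1∷ z) _ = s≤s (1+length≤posVal z)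
nonneg-length-bound (1∷ z) _ = m≤n⇒m≤1+n (1+length≤posVal z)

negative-length-bound : ∀ {L r a} → Zeck L false r → notPrefix101 (true ∷ r) ≡ true →
  posVal r + suc a ≡ F L → L ≤ suc (suc a)
negative-length-bound [] _ _ = z≤n
negative-length-bound (0∷ []) _ _ = s≤s z≤n
negative-length-bound (0∷ 1∷ _) () _
negative-length-bound {suc (suc L)} {a = a} (0∷ 0∷ z) _ sum =
  s≤s (s≤s (≤-trans (n≤F L) (≤-pred F<1+a)))
  where
  F<1+a : F L < suc a
  F<1+a = +-cancelˡ-< (F (suc L)) (F L) (suc a)
            (subst (_< F (suc L) + suc a) sum (+-monoˡ-< (suc a) (posVal-< z)))

length-bound : ∀ {L b r n} → Zeck (suc L) true (b ∷ r) →
  notPrefix000 (b ∷ r) ≡ true → notPrefix101 (b ∷ r) ≡ true →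
  Coordinate L b n (posVal r) → L ≤ suc ∣ n ∣
length-bound z no000 _ (nonneg _) = nonneg-length-bound (Zeck-tail z) no000
length-bound z _ no101 (neg _ sum) = negative-length-bound (Zeck-tail z) no101 sum

even-length : ∀ r → not (isOddLength r) ≡ true → ∃ λ m → length r ≡ 2 * m
even-length [] _ = 0 , refl
even-length (_ ∷ []) ()
even-length (_ ∷ _ ∷ r) even with even-length r (trans (sym (not-involutive _)) even)
... | m , |r|≡2m = suc m , trans (cong (λ l → suc (suc l)) |r|≡2m) (sym (*-suc 2 m))

IsRepF⇒Zeck : ∀ {n} w → IsRepF n w → ∃ λ m → Zeck (suc (2 * m)) true w × m ≤ suc ∣ n ∣
IsRepF⇒Zeck [] (() , _)
IsRepF⇒Zeck (b ∷ r) (inLang , refl) =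
  let odd , inLang′ = ∧-true (isOddLength (b ∷ r)) inLang
      no-11 , inLang″ = ∧-true (no11 (b ∷ r)) inLang′
      no000 , no101 = ∧-true (notPrefix000 (b ∷ r)) inLang″
      m , |r|≡2m = even-length r odd
      z = subst (λ l → Zeck (suc l) true (b ∷ r)) |r|≡2m (Zeck-cons b (Zeck-of-no11 b r no-11))
  in m , z , ≤-trans (m≤m+n m (m + 0)) (length-bound z no000 no101 (coordinate z))

⊔-≤-sum : ∀ {m₁ m₂} a b → m₁ ≤ suc a → m₂ ≤ suc b → m₁ ⊔ m₂ ≤ a + b + 1
⊔-≤-sum {m₁} {m₂} a b m₁≤ m₂≤ =
  subst (m₁ ⊔ m₂ ≤_) (+-comm 1 (a + b))
    (⊔-lub (≤-trans m₁≤ (s≤s (m≤m+n a b))) (≤-trans m₂≤ (s≤s (m≤n+m b a))))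

theorem2 : ∃ λ (A : DFAO) → ∀ (n₁ n₂ : ℤ) (w₁ w₂ : List Bool) →
               IsRepF n₁ w₁ → IsRepF n₂ w₂ →
               x (n₁ , n₂) ≡ output A (pairWord w₁ w₂)
theorem2 = 𝒜 , λ n₁ n₂ w₁ w₂ rep₁ rep₂ →
  let m₁ , z₁ , m₁≤ = IsRepF⇒Zeck w₁ rep₁
      m₂ , z₂ , m₂≤ = IsRepF⇒Zeck w₂ rep₂
      M = m₁ ⊔ m₂
      K = ∣ n₁ ∣ + ∣ n₂ ∣ + 1
      w₁′ = extend (M ∸ m₁) w₁
      w₂′ = extend (M ∸ m₂) w₂
  in begin
    x (n₁ , n₂)
      ≡⟨ cong₂ (λ v₁ v₂ → iterSeed K (v₁ , v₂)) (trans (valF-extend (M ∸ m₁) w₁) (proj₂ rep₁))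
                                                 (trans (valF-extend (M ∸ m₂) w₂) (proj₂ rep₂)) ⟨
    iterSeed K (valF w₁′ , valF w₂′)
      ≡⟨ iterSeed-output-≤ {K} {M} {w₁′} {w₂′} (⊔-≤-sum ∣ n₁ ∣ ∣ n₂ ∣ m₁≤ m₂≤)
           (Zeck-extend {m₁} {M} (m≤m⊔n m₁ m₂) z₁) (Zeck-extend {m₂} {M} (m≤n⊔m m₁ m₂) z₂) ⟩
    output 𝒜 (zip w₁′ w₂′)
      ≡⟨ cong (output 𝒜) (pairWord-extend {m₁} {m₂} z₁ z₂) ⟨
    output 𝒜 (pairWord w₁ w₂) ∎
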